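{- Let $a,\delta$ be positive integers with $a<\delta<2a$ and $\gcd(a,\delta)=1$, and put $b=a+\delta$. For $n\ge 0$ let $w_n = n + a\lfloor n/a\rfloor + b\lfloor n/\delta\rfloor$, let $\mathcal W_0=\{w_n:n\ge 0\}$ and $\mathcal W_3=(\mathcal W_0-\delta)\setminus\mathcal W_0$. Then: (i) if $n<a$ then $w_n<\delta$; (ii) if $a\le n<\delta$ then $w_n-\delta\in\mathcal W_0$; (iii) if $n\ge\delta$ then $w_n-\delta\ge a+b$. In particular every element $x\in\mathcal W_3$ satisfies $x\ge a+b$.
   Context: For $X\subseteq\mathbb N$ and $y\in\mathbb N$, $X-y=\{x-y : x\in X,\ x\ge y\}$. -}

module Defs where

open import Data.Nat using (ℕ; _+_; _*_; _∸_; _/_; _≤_; NonZero)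
open import Data.Product using (∃; _×_)
open import Relation.Binary.PropositionalEquality using (_≡_)
open import Relation.Nullary using (¬_)

w : (a δ : ℕ) → .{{NonZero a}} → .{{NonZero δ}} → ℕ → ℕ
w a δ n = n + a * (n / a) + (a + δ) * (n / δ)

InW0 : (a δ : ℕ) → .{{NonZero a}} → .{{NonZero δ}} → ℕ → Set
InW0 a δ x = ∃ λ n → w a δ n ≡ x

InW0-δ : (a δ : ℕ) → .{{NonZero a}} → .{{NonZero δ}} → ℕ → Set
InW0-δ a δ x = ∃ λ y → InW0 a δ y × δ ≤ y × x ≡ y ∸ δ

InW3 : (a δ : ℕ) → .{{NonZero a}} → .{{NonZero δ}} → ℕ → Set
InW3 a δ x = InW0-δ a δ x × ¬ InW0 a δ x

-- For n < a both quotients vanish, so w_n = n; for a ≤ n < δ (< 2a) only ⌊n/a⌋ = 1 survives,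
-- so w_n − δ = n + a − δ is itself some w_m with m < a; for n ≥ δ both quotients are at
-- least 1, giving w_n ≥ n + a + b. An element w_n − δ of W₃ therefore can only come from n ≥ δ.
module Submission where

open import Defs
open import Data.Nat using (ℕ; _+_; _*_; _∸_; _<_; _≤_; NonZero; _/_; _<?_; s≤s⁻¹)
open import Data.Nat.Properties
open import Data.Nat.DivMod using (m<n⇒m/n≡0; m≥n⇒m/n>0; m<n*o⇒m/o<n)
open import Data.Nat.GCD using (gcd)
open import Data.Product using (_×_; _,_)
open import Relation.Binary.PropositionalEquality using (_≡_; refl; sym; cong; subst; module ≡-Reasoning)
open import Relation.Nullary using (yes; no; contradiction)

m≤m*[n/o] : ∀ m {n o} .{{_ : NonZero o}} → o ≤ n → m ≤ m * (n / o)
m≤m*[n/o] m o≤n = ≤-trans (≤-reflexive (sym (*-identityʳ m))) (*-monoʳ-≤ m (m≥n⇒m/n>0 o≤n))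

m/n≡1 : ∀ {m n} .{{_ : NonZero n}} → n ≤ m → m < 2 * n → m / n ≡ 1
m/n≡1 n≤m m<2n = ≤-antisym (s≤s⁻¹ (m<n*o⇒m/o<n m<2n)) (m≥n⇒m/n>0 n≤m)

module _ (a δ : ℕ) .{{_ : NonZero a}} .{{_ : NonZero δ}} where

  w≡n : ∀ {n} → n < a → n < δ → w a δ n ≡ n
  w≡n {n} n<a n<δ rewrite m<n⇒m/n≡0 n<a | m<n⇒m/n≡0 n<δ
    | *-zeroʳ a | *-zeroʳ (a + δ) | +-identityʳ n | +-identityʳ n = refl

  w≡n+a : ∀ {n} → a ≤ n → n < 2 * a → n < δ → w a δ n ≡ n + a
  w≡n+a {n} a≤n n<2a n<δ rewrite m/n≡1 a≤n n<2a | m<n⇒m/n≡0 n<δ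
    | *-identityʳ a | *-zeroʳ (a + δ) | +-identityʳ (n + a) = refl

  n+a+b≤w : ∀ {n} → a ≤ n → δ ≤ n → n + a + (a + δ) ≤ w a δ n
  n+a+b≤w {n} a≤n δ≤n = +-mono-≤ (+-monoʳ-≤ n (m≤m*[n/o] a a≤n)) (m≤m*[n/o] (a + δ) δ≤n)

  module _ (a<δ : a < δ) (δ<2a : δ < 2 * a) where

    w<δ : ∀ n → n < a → w a δ n < δ
    w<δ n n<a = subst (_< δ) (sym (w≡n n<a n<δ)) n<δ
      where n<δ = <-trans n<a a<δ

    w∸δ∈W₀ : ∀ n → a ≤ n → n < δ → InW0 a δ (w a δ n ∸ δ)
    w∸δ∈W₀ n a≤n n<δ = m , (begin
        w a δ m       ≡⟨ w≡n m<a (<-trans m<a a<δ) ⟩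
        n + a ∸ δ     ≡⟨ cong (_∸ δ) (w≡n+a a≤n (<-trans n<δ δ<2a) n<δ) ⟨
        w a δ n ∸ δ   ∎)
      where
      open ≡-Reasoning
      m = n + a ∸ δ
      m<a : m < a
      m<a = m<n+o⇒m∸n<o (n + a) δ (+-monoˡ-< a n<δ)

    a+b≤w∸δ : ∀ n → δ ≤ n → a + (a + δ) ≤ w a δ n ∸ δ
    a+b≤w∸δ n δ≤n = m+n≤o⇒m≤o∸n (a + (a + δ)) (begin
        a + (a + δ) + δ   ≡⟨ +-comm (a + (a + δ)) δ ⟩
        δ + (a + (a + δ)) ≤⟨ +-monoˡ-≤ (a + (a + δ)) δ≤n ⟩
        n + (a + (a + δ)) ≡⟨ +-assoc n a (a + δ) ⟨
        n + a + (a + δ)   ≤⟨ n+a+b≤w (≤-trans (<⇒≤ a<δ) δ≤n) δ≤n ⟩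
        w a δ n           ∎)
      where open ≤-Reasoning

    W₃⇒a+b≤ : ∀ x → InW3 a δ x → a + (a + δ) ≤ x
    W₃⇒a+b≤ x ((_ , (n , refl) , δ≤wn , refl) , x∉W₀) with n <? a | n <? δ
    ... | yes n<a | _       = contradiction δ≤wn (<⇒≱ (w<δ n n<a))
    ... | no n≮a  | yes n<δ = contradiction (w∸δ∈W₀ n (≮⇒≥ n≮a) n<δ) x∉W₀
    ... | no _    | no n≮δ  = a+b≤w∸δ n (≮⇒≥ n≮δ)

lemma3p2 : (a δ : ℕ) → .{{_ : NonZero a}} → .{{_ : NonZero δ}} →
    a < δ → δ < 2 * a → gcd a δ ≡ 1 →
    ((n : ℕ) → n < a → w a δ n < δ)
    × ((n : ℕ) → a ≤ n → n < δ → InW0 a δ (w a δ n ∸ δ))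
    × ((n : ℕ) → δ ≤ n → a + (a + δ) ≤ w a δ n ∸ δ)
    × ((x : ℕ) → InW3 a δ x → a + (a + δ) ≤ x)
lemma3p2 a δ a<δ δ<2a _ =
  w<δ a δ a<δ δ<2a , w∸δ∈W₀ a δ a<δ δ<2a , a+b≤w∸δ a δ a<δ δ<2a , W₃⇒a+b≤ a δ a<δ δ<2a
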